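{- Let $X$ be a layer-latin cube of order $5$ and let $A'$ be the $3$-layer latin cuboid formed by some three layers of $X$. If for some label $i$ and some adjacent labels $j,k$ one has $T(A')(i,j)+T(A')(i,k)\ge 19$ or $T(A')(j,i)+T(A')(k,i)\ge 19$, then $X$ has a transversal.
   Context: $Q_5=\{0,\dots,4\}$. A layer-latin cube of order $5$ is an array $X$ with cells $(l,r,c)$, $l,r,c\in Q_5$ (layer, row, column) and entries in $Q_5$, each layer being a latin square of order $5$; a $3$-layer latin cuboid formed by three layers keeps their row and column coordinates. A transversal of $X$ is a set of $5$ cells with pairwise distinct layers, rows, columns and symbols. Fix a numbering $S_1,\dots,S_{10}$ (labels) of the $2$-element subsets of $Q_5$; labels $j\ne k$ are adjacent if $S_j\cap S_k\neq\emptyset$. A diagonal of a $3\times3\times3$ array is a set of $3$ cells any two of which differ in all three coordinates; a transversal is a diagonal with pairwise distinct symbols, its range is the set of its symbols. For a $3$-layer latin cuboid $A'$ of order $5$, $T(A')(i,j)$ is the number of distinct ranges of transversals of the $3\times3\times3$ subarray of $A'$ with rows in $Q_5\setminus S_i$ and columns in $Q_5\setminus S_j$. -}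

module Defs where

open import Data.Nat using (ℕ; _≥_; _+_)
open import Data.Fin using (Fin; zero; suc; _≟_)
open import Data.Fin.Subset using (Subset; ⁅_⁆; _∪_)
open import Data.Bool using (Bool; true; false; _∧_; _∨_; not)
import Data.Bool as B
open import Data.List using (List; []; _∷_; length; filter; map; concatMap; deduplicate; allFin)
open import Data.Vec.Properties using (≡-dec)
open import Data.Product using (_×_; _,_; ∃)
open import Relation.Binary.PropositionalEquality using (_≡_; _≢_)
open import Relation.Nullary.Decidable using (⌊_⌋)
open import Function.Definitions using (Injective)

Q5 : Set
Q5 = Fin 5

-- A latin square of order 5: every symbol occurs at most (hence exactly) once
-- in each row and in each column.
IsLatinSquare : (Q5 → Q5 → Q5) → Set
IsLatinSquare L =
  (∀ r → Injective _≡_ _≡_ (λ c → L r c)) × (∀ c → Injective _≡_ _≡_ (λ r → L r c))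

-- Layer-latin cube of order 5: X l r c, each layer a latin square.
Cube : Set
Cube = Q5 → Q5 → Q5 → Q5

IsLayerLatinCube : Cube → Set
IsLayerLatinCube X = ∀ l → IsLatinSquare (X l)

HasTransversal : Cube → Set
HasTransversal X =
  ∃ λ (lay : Fin 5 → Q5) → ∃ λ (row : Fin 5 → Q5) → ∃ λ (col : Fin 5 → Q5) →
    ∀ a b → a ≢ b →
      (lay a ≢ lay b) × (row a ≢ row b) × (col a ≢ col b) ×
      (X (lay a) (row a) (col a) ≢ X (lay b) (row b) (col b))

Cuboid : Set
Cuboid = Fin 3 → Q5 → Q5 → Q5

layersOf : Cube → (Fin 3 → Q5) → Cuboid
layersOf X ls k r c = X (ls k) r c

-- A fixed numbering S_1..S_10 of the 2-element subsets of Q_5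
-- (label m ∈ Fin 10 stands for S_{m+1}); S m = {a , b} with a < b.
Label : Set
Label = Fin 10

S : Label → Q5 × Q5
S zero = (zero , suc zero)
S (suc zero) = (zero , suc (suc zero))
S (suc (suc zero)) = (zero , suc (suc (suc zero)))
S (suc (suc (suc zero))) = (zero , suc (suc (suc (suc zero))))
S (suc (suc (suc (suc zero)))) = (suc zero , suc (suc zero))
S (suc (suc (suc (suc (suc zero))))) = (suc zero , suc (suc (suc zero)))
S (suc (suc (suc (suc (suc (suc zero)))))) = (suc zero , suc (suc (suc (suc zero))))
S (suc (suc (suc (suc (suc (suc (suc zero))))))) = (suc (suc zero) , suc (suc (suc zero)))
S (suc (suc (suc (suc (suc (suc (suc (suc zero)))))))) = (suc (suc zero) , suc (suc (suc (suc zero))))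
S (suc (suc (suc (suc (suc (suc (suc (suc (suc zero)))))))))  = (suc (suc (suc zero)) , suc (suc (suc (suc zero))))

_∈S_ : Q5 → Label → Set
x ∈S m with S m
... | (a , b) = (x ≡ a) Data.Sum.⊎ (x ≡ b)
  where import Data.Sum

inSᵇ : Q5 → Label → Bool
inSᵇ x m with S m
... | (a , b) = ⌊ x ≟ a ⌋ ∨ ⌊ x ≟ b ⌋

Adjacent : Label → Label → Set
Adjacent j k = (j ≢ k) × ∃ λ x → (x ∈S j) × (x ∈S k)

Cell : Set
Cell = Fin 3 × Q5 × Q5

layerOf : Cell → Fin 3
layerOf (l , _ , _) = l
rowOf : Cell → Q5
rowOf (_ , r , _) = r
colOf : Cell → Q5
colOf (_ , _ , c) = c

_≠ᵇ_ : ∀ {n} → Fin n → Fin n → Bool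
a ≠ᵇ b = not ⌊ a ≟ b ⌋

differAll : Cell → Cell → Bool
differAll x y = (layerOf x ≠ᵇ layerOf y) ∧ (rowOf x ≠ᵇ rowOf y) ∧ (colOf x ≠ᵇ colOf y)

subCells : Label → Label → List Cell
subCells i j =
  concatMap (λ l → concatMap (λ r → map (λ c → (l , r , c))
      (filter (λ c → B.T? (not (inSᵇ c j))) (allFin 5)))
    (filter (λ r → B.T? (not (inSᵇ r i))) (allFin 5)))
  (allFin 3)

triples : Label → Label → List (Cell × Cell × Cell)
triples i j = concatMap (λ x → concatMap (λ y → map (λ z → (x , y , z)) (subCells i j))
                                          (subCells i j)) (subCells i j)

isTransversalᵇ : Cuboid → Cell × Cell × Cell → Bool
isTransversalᵇ A (x , y , z) =
  differAll x y ∧ differAll x z ∧ differAll y z ∧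
  (sym x ≠ᵇ sym y) ∧ (sym x ≠ᵇ sym z) ∧ (sym y ≠ᵇ sym z)
  where
  sym : Cell → Q5
  sym (l , r , c) = A l r c

range : Cuboid → Cell × Cell × Cell → Subset 5
range A ((l₁ , r₁ , c₁) , (l₂ , r₂ , c₂) , (l₃ , r₃ , c₃)) =
  ⁅ A l₁ r₁ c₁ ⁆ ∪ ⁅ A l₂ r₂ c₂ ⁆ ∪ ⁅ A l₃ r₃ c₃ ⁆

T : Cuboid → Label → Label → ℕ
T A i j = length (deduplicate (≡-dec B._≟_)
  (map (range A) (filter (λ t → B.T? (isTransversalᵇ A t)) (triples i j))))

-- Let m, n be the two layers of X outside the cuboid, S_i = {a, b}, S_j = {x, y} and S_k = {x, z}.
-- If a transversal of the subarray for (i, l) has range Q_5 ∖ {X m a c, X n b c′} with c ≠ c′ in S_l,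
-- the cells (m, a, c) and (n, b, c′) complete it to a transversal of X. Ranges are 3-subsets of Q_5,
-- so T ≤ 10, and the bound 19 forces one subarray to realise all ten 3-subsets and the other all but
-- at most one. If both candidates (x, z) and (z, x) fail for the first, then X m a x = X n b z and
-- X m a z = X n b x; as the rows X m a and X n b are injective, the candidates (x, y) and (y, x)
-- then give two distinct 3-subsets, one of which the second subarray realises. For columns exchange
-- the roles of rows and columns.
module Submission where

open import Defs
open import Data.Nat using (suc; _+_; _≤_; _<_; _≥_; z≤n; s≤s)
open import Data.Nat.Properties using (+-comm; ≤-pred; ≤-trans; ≤-<-trans; +-cancelʳ-≤; +-monoʳ-≤; 1+n≰n; _≤?_; ≰⇒>)
open import Data.Fin using (Fin; zero; suc; _≟_)
open import Data.Fin.Subset using (Subset; ⁅_⁆; _∪_; ∁) renaming (_∈_ to _∈ₛ_; _∉_ to _∉ₛ_)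
open import Data.Fin.Subset.Properties using (x∈⁅x⁆; x∈⁅y⁆⇒x≡y; x∈p∪q⁻; x∈p∪q⁺; x∈∁p⇒x∉p; x∉∁p⇒x∈p)
open import Data.Fin.Properties using (all?; any?)
open import Data.Bool using (true; false; not; _∧_)
open import Data.Bool.Properties using (T-∧; T-∨)
import Data.Bool as B
open import Data.List using (List; []; _∷_; length; filter; map; deduplicate; allFin; lookup)
open import Data.List.Membership.Propositional using (_∈_; _∉_)
open import Data.List.Membership.Propositional.Properties using (∈-lookup; ∈-filter⁺; ∈-filter⁻; ∈-map⁻; ∈-concatMap⁻; ∈-deduplicate⁻)
import Data.List.Membership.Propositional as Membership
import Data.List.Membership.DecPropositional as DecMembership
open import Data.List.Properties using (filter-notAll)
open import Data.List.Relation.Binary.Subset.Propositional using (_⊆_)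
open import Data.List.Relation.Unary.All using (All; []; _∷_)
import Data.List.Relation.Unary.All as All
open import Data.List.Relation.Unary.All.Properties using (All¬⇒¬Any)
open import Data.List.Relation.Unary.Any using (here; there)
import Data.List.Relation.Unary.Any as Any
open import Data.List.Relation.Unary.AllPairs using (AllPairs; []; _∷_)
open import Data.List.Relation.Unary.Unique.Propositional using (Unique)
open import Data.List.Relation.Unary.Unique.DecPropositional.Properties using (deduplicate-!)
open import Data.Vec.Properties using (≡-dec)
open import Data.Product using (_×_; _,_; ∃; ∃₂; proj₁; proj₂)
open import Data.Sum using (_⊎_; inj₁; inj₂; [_,_]′)
import Data.Sum as Sum
open import Data.Empty using (⊥-elim)
open import Data.Unit using (tt)
open import Function using (_∘_; Equivalence)
open import Function.Definitions using (Injective)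
open import Relation.Binary.Definitions using (Symmetric; DecidableEquality)
open import Relation.Binary.PropositionalEquality using (_≡_; _≢_; refl; sym; trans; cong; subst)
open import Relation.Nullary using (Dec; yes; no; ¬?)
open import Relation.Nullary.Decidable using (⌊_⌋; toWitness; fromWitness; toWitnessFalse; _→-dec_; _×-dec_)

-- Counting duplicate-free sublists

module _ {A : Set} (_≟ₐ_ : DecidableEquality A) where

  open DecMembership _≟ₐ_ using (_∈?_)

  private
    without : A → List A → List A
    without w = filter (¬? ∘ (w ≟ₐ_))

    length-without-< : ∀ {w ys} → w ∈ ys → length (without w ys) < length ys
    length-without-< {ys = ys} w∈ys = filter-notAll _ ys (Any.map (λ w≡v w≢v → w≢v w≡v) w∈ys)

    ⊆-without : ∀ {w xs ys} → xs ⊆ ys → w ∉ xs → xs ⊆ without w ys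
    ⊆-without {xs = xs} xs⊆ys w∉xs v∈xs =
      ∈-filter⁺ _ (xs⊆ys v∈xs) (λ w≡v → w∉xs (subst (_∈ xs) (sym w≡v) v∈xs))

  Unique-length-≤ : ∀ {xs ys} → Unique xs → xs ⊆ ys → length xs ≤ length ys
  Unique-length-≤ {[]}     []              _     = z≤n
  Unique-length-≤ {x ∷ xs} (x≢xs ∷ unique) xs⊆ys =
    ≤-<-trans (Unique-length-≤ unique (⊆-without (xs⊆ys ∘ there) (All¬⇒¬Any x≢xs)))
              (length-without-< (xs⊆ys (here refl)))

  Unique-length-< : ∀ {w xs ys} → Unique xs → xs ⊆ ys → w ∈ ys → w ∉ xs → length xs < length ys
  Unique-length-< unique xs⊆ys w∈ys w∉xs =
    ≤-<-trans (Unique-length-≤ unique (⊆-without xs⊆ys w∉xs)) (length-without-< w∈ys)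

  ∈-of-length : ∀ {w xs ys} → Unique xs → xs ⊆ ys → length ys ≤ length xs → w ∈ ys → w ∈ xs
  ∈-of-length {w} {xs} unique xs⊆ys long w∈ys with w ∈? xs
  ... | yes w∈xs = w∈xs
  ... | no  w∉xs = ⊥-elim (1+n≰n (≤-trans (Unique-length-< unique xs⊆ys w∈ys w∉xs) long))

  ∈-either-of-length : ∀ {w w′ xs ys} → Unique xs → xs ⊆ ys → length ys ≤ suc (length xs) →
    w ∈ ys → w′ ∈ ys → w ≢ w′ → w ∈ xs ⊎ w′ ∈ xs
  ∈-either-of-length {w} {w′} {xs} {ys} unique xs⊆ys long w∈ys w′∈ys w≢w′ with w ∈? xs | w′ ∈? xs
  ... | yes w∈xs | _         = inj₁ w∈xs
  ... | no  _    | yes w′∈xs = inj₂ w′∈xs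
  ... | no  w∉xs | no  w′∉xs = ⊥-elim (1+n≰n (≤-trans shorter long))
    where
    shorter : suc (length xs) < length ys
    shorter = ≤-<-trans
      (Unique-length-< unique (⊆-without xs⊆ys w∉xs) (∈-filter⁺ _ w′∈ys w≢w′) w′∉xs)
      (length-without-< w∈ys)

lookup-AllPairs : ∀ {A : Set} {R : A → A → Set} {xs : List A} → Symmetric R → AllPairs R xs →
  ∀ a b → a ≢ b → R (lookup xs a) (lookup xs b)
lookup-AllPairs _   (_  ∷ _)   zero    zero    a≢b = ⊥-elim (a≢b refl)
lookup-AllPairs _   (Rx ∷ _)   zero    (suc b) _   = All.lookup Rx (∈-lookup b)
lookup-AllPairs sym (Rx ∷ _)   (suc a) zero    _   = sym (All.lookup Rx (∈-lookup a))
lookup-AllPairs sym (_  ∷ Rxs) (suc a) (suc b) a≢b = lookup-AllPairs sym Rxs a b (a≢b ∘ cong suc)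

-- Three-element subsets of Q5

∁⁅_,_⁆ : Q5 → Q5 → Subset 5
∁⁅ s , t ⁆ = ∁ (⁅ s ⁆ ∪ ⁅ t ⁆)

∈∁⁅⁆⇒≢ : ∀ {v s t} → v ∈ₛ ∁⁅ s , t ⁆ → v ≢ s × v ≢ t
∈∁⁅⁆⇒≢ {s = s} {t} v∈ = (λ { refl → x∈∁p⇒x∉p v∈ (x∈p∪q⁺ (inj₁ (x∈⁅x⁆ s))) })
                      , (λ { refl → x∈∁p⇒x∉p v∈ (x∈p∪q⁺ (inj₂ (x∈⁅x⁆ t))) })

∁⁅⁆-≡⇒ : ∀ {s t s′ t′} → ∁⁅ s , t ⁆ ≡ ∁⁅ s′ , t′ ⁆ → s ≡ s′ ⊎ s ≡ t′
∁⁅⁆-≡⇒ {s} {t} {s′} {t′} eq =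
  Sum.map (x∈⁅y⁆⇒x≡y s′) (x∈⁅y⁆⇒x≡y t′) (x∈p∪q⁻ ⁅ s′ ⁆ ⁅ t′ ⁆ (x∉∁p⇒x∈p s∉))
  where
  s∉ : s ∉ₛ ∁⁅ s′ , t′ ⁆
  s∉ s∈ = proj₁ (∈∁⁅⁆⇒≢ (subst (s ∈ₛ_) (sym eq) s∈)) refl

threeSubsets : List (Subset 5)
threeSubsets = map (λ l → ∁⁅ proj₁ (S l) , proj₂ (S l) ⁆) (allFin 10)

∁⁅⁆∈threeSubsets : ∀ s t → s ≢ t → ∁⁅ s , t ⁆ ∈ threeSubsets
∁⁅⁆∈threeSubsets = toWitness {a? = all? λ s → all? λ t →
  ¬? (s ≟ t) →-dec DecMembership._∈?_ (≡-dec B._≟_) ∁⁅ s , t ⁆ threeSubsets} tt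

⁅⁆∪⁅⁆∪⁅⁆∈threeSubsets : ∀ a b c → a ≢ b → a ≢ c → b ≢ c → ⁅ a ⁆ ∪ ⁅ b ⁆ ∪ ⁅ c ⁆ ∈ threeSubsets
⁅⁆∪⁅⁆∪⁅⁆∈threeSubsets = toWitness {a? = all? λ a → all? λ b → all? λ c →
  ¬? (a ≟ b) →-dec ¬? (a ≟ c) →-dec ¬? (b ≟ c) →-dec
  DecMembership._∈?_ (≡-dec B._≟_) (⁅ a ⁆ ∪ ⁅ b ⁆ ∪ ⁅ c ⁆) threeSubsets} tt

_∈Sᵇ_ : Q5 → Label → Set
x ∈Sᵇ i = B.T (inSᵇ x i)

∈S⇒∈Sᵇ : ∀ {x} i → x ∈S i → x ∈Sᵇ i
∈S⇒∈Sᵇ {x} i x∈ with S i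
... | a , b = Equivalence.from (T-∨ {⌊ x ≟ a ⌋}) (Sum.map fromWitness fromWitness x∈)

∉Sᵇ-∈Sᵇ⇒≢ : ∀ {x y} i → B.T (not (inSᵇ x i)) → y ∈Sᵇ i → x ≢ y
∉Sᵇ-∈Sᵇ⇒≢ {x} i x∉ y∈ refl with inSᵇ x i
... | true  = x∉
... | false = y∈

ElemsOf : Label → Q5 → Q5 → Set
ElemsOf i a b = a ≢ b × a ∈Sᵇ i × b ∈Sᵇ i

ElemsOf-swap : ∀ {i a b} → ElemsOf i a b → ElemsOf i b a
ElemsOf-swap (a≢b , a∈ , b∈) = a≢b ∘ sym , b∈ , a∈

elemsOf : ∀ i → ∃₂ (ElemsOf i)
elemsOf = toWitness {a? = all? λ i → any? λ a → any? λ b →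
  ¬? (a ≟ b) ×-dec B.T? (inSᵇ a i) ×-dec B.T? (inSᵇ b i)} tt

adjacent-elemsOf : ∀ j k x → j ≢ k → x ∈Sᵇ j → x ∈Sᵇ k →
  ∃₂ λ y z → y ≢ z × ElemsOf j x y × ElemsOf k x z
adjacent-elemsOf = toWitness {a? = all? λ j → all? λ k → all? λ x →
  ¬? (j ≟ k) →-dec B.T? (inSᵇ x j) →-dec B.T? (inSᵇ x k) →-dec
  any? λ y → any? λ z → ¬? (y ≟ z) ×-dec
    (¬? (x ≟ y) ×-dec B.T? (inSᵇ x j) ×-dec B.T? (inSᵇ y j)) ×-dec
    (¬? (x ≟ z) ×-dec B.T? (inSᵇ x k) ×-dec B.T? (inSᵇ z k))} tt

Point : Set
Point = Q5 × Q5 × Q5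

Apart : Cube → Point → Point → Set
Apart X (l , r , c) (l′ , r′ , c′) = l ≢ l′ × r ≢ r′ × c ≢ c′ × X l r c ≢ X l′ r′ c′

Apart-sym : ∀ X → Symmetric (Apart X)
Apart-sym X (l≢ , r≢ , c≢ , x≢) = l≢ ∘ sym , r≢ ∘ sym , c≢ ∘ sym , x≢ ∘ sym

transversal-of-Apart : ∀ X {p₀ p₁ p₂ p₃ p₄} → AllPairs (Apart X) (p₀ ∷ p₁ ∷ p₂ ∷ p₃ ∷ p₄ ∷ []) →
  HasTransversal X
transversal-of-Apart X {p₀} {p₁} {p₂} {p₃} {p₄} apart =
  proj₁ ∘ point , proj₁ ∘ proj₂ ∘ point , proj₂ ∘ proj₂ ∘ point ,
  lookup-AllPairs (Apart-sym X) apart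
  where
  point : Fin 5 → Point
  point = lookup (p₀ ∷ p₁ ∷ p₂ ∷ p₃ ∷ p₄ ∷ [])

record OtherLayers (ls : Fin 3 → Q5) : Set where
  field
    m n  : Q5
    m≢n  : m ≢ n
    ls≢m : ∀ l → ls l ≢ m
    ls≢n : ∀ l → ls l ≢ n

avoid₃ : ∀ (a b c : Q5) → ∃₂ λ m n → m ≢ n × (a ≢ m × b ≢ m × c ≢ m) × (a ≢ n × b ≢ n × c ≢ n)
avoid₃ = toWitness {a? = all? λ a → all? λ b → all? λ c → any? λ m → any? λ n →
  ¬? (m ≟ n) ×-dec (¬? (a ≟ m) ×-dec ¬? (b ≟ m) ×-dec ¬? (c ≟ m))
             ×-dec (¬? (a ≟ n) ×-dec ¬? (b ≟ n) ×-dec ¬? (c ≟ n))} tt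

otherLayers : ∀ ls → OtherLayers ls
otherLayers ls =
  let m , n , m≢n , ≢m , ≢n = avoid₃ (ls zero) (ls (suc zero)) (ls (suc (suc zero)))
  in record { m = m ; n = n ; m≢n = m≢n ; ls≢m = pick ≢m ; ls≢n = pick ≢n }
  where
  pick : ∀ {v} → ls zero ≢ v × ls (suc zero) ≢ v × ls (suc (suc zero)) ≢ v → ∀ l → ls l ≢ v
  pick (≢₀ , _  , _ ) zero             = ≢₀
  pick (_  , ≢₁ , _ ) (suc zero)       = ≢₁
  pick (_  , _  , ≢₂) (suc (suc zero)) = ≢₂

-- Transversals of the 3 × 3 × 3 subarrays

-- T A i j is definitionally length (ranges A i j).
ranges : Cuboid → Label → Label → List (Subset 5)
ranges A i j = deduplicate (≡-dec B._≟_)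
  (map (range A) (filter (λ t → B.T? (isTransversalᵇ A t)) (triples i j)))

ranges-Unique : ∀ A i j → Unique (ranges A i j)
ranges-Unique A i j = deduplicate-! (≡-dec B._≟_) _

∈ranges⁻ : ∀ {A i j V} → V ∈ ranges A i j →
  ∃ λ t → t ∈ triples i j × B.T (isTransversalᵇ A t) × V ≡ range A t
∈ranges⁻ {A} {i} {j} V∈ with ∈-map⁻ (range A) (∈-deduplicate⁻ (≡-dec B._≟_) _ V∈)
... | t , t∈ , refl =
  let t∈triples , transversal = ∈-filter⁻ (λ t → B.T? (isTransversalᵇ A t)) {xs = triples i j} t∈
  in t , t∈triples , transversal , refl

InSubarray : Label → Label → Cell → Set
InSubarray i j (_ , r , c) = B.T (not (inSᵇ r i)) × B.T (not (inSᵇ c j))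

∉Sᵇ? : (i : Label) (r : Q5) → Dec (B.T (not (inSᵇ r i)))
∉Sᵇ? i r = B.T? (not (inSᵇ r i))

∈subCells⁻ : ∀ {i j x} → x ∈ subCells i j → InSubarray i j x
∈subCells⁻ {i} {j} x∈ with Membership.find (∈-concatMap⁻ _ {xs = allFin 3} x∈)
... | l , _ , x∈ₗ with Membership.find (∈-concatMap⁻ _ {xs = filter (∉Sᵇ? i) (allFin 5)} x∈ₗ)
... | r , r∈ , x∈ₗᵣ with ∈-map⁻ (λ c → (l , r , c)) x∈ₗᵣ
... | c , c∈ , refl = proj₂ (∈-filter⁻ (∉Sᵇ? i) {xs = allFin 5} r∈) , proj₂ (∈-filter⁻ (∉Sᵇ? j) {xs = allFin 5} c∈)

∈triples⁻ : ∀ {i j x y z} → (x , y , z) ∈ triples i j →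
  InSubarray i j x × InSubarray i j y × InSubarray i j z
∈triples⁻ {i} {j} t∈ with Membership.find (∈-concatMap⁻ _ {xs = subCells i j} t∈)
... | x , x∈ , t∈ₓ with Membership.find (∈-concatMap⁻ _ {xs = subCells i j} t∈ₓ)
... | y , y∈ , t∈ₓᵧ with ∈-map⁻ (λ z → (x , y , z)) t∈ₓᵧ
... | z , z∈ , refl = ∈subCells⁻ {i} {j} x∈ , ∈subCells⁻ {i} {j} y∈ , ∈subCells⁻ {i} {j} z∈

symbolAt : Cuboid → Cell → Q5
symbolAt A (l , r , c) = A l r c

∧⁻ : ∀ a {b} → B.T (a ∧ b) → B.T a × B.T b
∧⁻ _ = Equivalence.to T-∧

≠ᵇ⁻ : ∀ {n} {a b : Fin n} → B.T (a ≠ᵇ b) → a ≢ b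
≠ᵇ⁻ = toWitnessFalse

differAll⁻ : ∀ {x y} → B.T (differAll x y) →
  layerOf x ≢ layerOf y × rowOf x ≢ rowOf y × colOf x ≢ colOf y
differAll⁻ {x} {y} d =
  let dl , d′ = ∧⁻ (layerOf x ≠ᵇ layerOf y) d
      dr , dc = ∧⁻ (rowOf x ≠ᵇ rowOf y) d′
  in ≠ᵇ⁻ dl , ≠ᵇ⁻ dr , ≠ᵇ⁻ dc

isTransversalᵇ⁻ : ∀ {A x y z} → B.T (isTransversalᵇ A (x , y , z)) →
  (B.T (differAll x y) × B.T (differAll x z) × B.T (differAll y z)) ×
  (symbolAt A x ≢ symbolAt A y × symbolAt A x ≢ symbolAt A z × symbolAt A y ≢ symbolAt A z)
isTransversalᵇ⁻ {A} {x} {y} {z} t =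
  let dxy , t₁  = ∧⁻ (differAll x y) t
      dxz , t₂  = ∧⁻ (differAll x z) t₁
      dyz , t₃  = ∧⁻ (differAll y z) t₂
      sxy , t₄  = ∧⁻ (symbolAt A x ≠ᵇ symbolAt A y) t₃
      sxz , syz = ∧⁻ (symbolAt A x ≠ᵇ symbolAt A z) t₄
  in (dxy , dxz , dyz) , ≠ᵇ⁻ sxy , ≠ᵇ⁻ sxz , ≠ᵇ⁻ syz

range∈threeSubsets : ∀ {A t} → B.T (isTransversalᵇ A t) → range A t ∈ threeSubsets
range∈threeSubsets {A} {x , y , z} transversal =
  let _ , sxy , sxz , syz = isTransversalᵇ⁻ {A} {x} {y} {z} transversal
  in ⁅⁆∪⁅⁆∪⁅⁆∈threeSubsets _ _ _ sxy sxz syz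

ranges⊆threeSubsets : ∀ {A i j} → ranges A i j ⊆ threeSubsets
ranges⊆threeSubsets {A} {i} {j} V∈ with ∈ranges⁻ {A} {i} {j} V∈
... | t , _ , transversal , refl = range∈threeSubsets {A} {t} transversal

Full : List (Subset 5) → Set
Full D = ∀ {s t} → s ≢ t → ∁⁅ s , t ⁆ ∈ D

AlmostFull : List (Subset 5) → Set
AlmostFull D = ∀ {s t s′ t′} → s ≢ t → s′ ≢ t′ → ∁⁅ s , t ⁆ ≢ ∁⁅ s′ , t′ ⁆ →
  ∁⁅ s , t ⁆ ∈ D ⊎ ∁⁅ s′ , t′ ⁆ ∈ D

module _ {D : List (Subset 5)} (unique : Unique D) (D⊆ : D ⊆ threeSubsets) where

  length≤10 : length D ≤ 10
  length≤10 = Unique-length-≤ (≡-dec B._≟_) unique D⊆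

  Full-of-length : 10 ≤ length D → Full D
  Full-of-length long s≢t = ∈-of-length (≡-dec B._≟_) unique D⊆ long (∁⁅⁆∈threeSubsets _ _ s≢t)

  AlmostFull-of-length : 9 ≤ length D → AlmostFull D
  AlmostFull-of-length long s≢t s′≢t′ =
    ∈-either-of-length (≡-dec B._≟_) unique D⊆ (s≤s long)
      (∁⁅⁆∈threeSubsets _ _ s≢t) (∁⁅⁆∈threeSubsets _ _ s′≢t′)

≤-of-+ : ∀ {k l m n} → n ≤ k → l + k ≤ m + n → l ≤ m
≤-of-+ {k} {l} {m} n≤k le = +-cancelʳ-≤ k l m (≤-trans le (+-monoʳ-≤ m n≤k))

split-19 : ∀ {m n} → m ≤ 10 → n ≤ 10 → 19 ≤ m + n → (10 ≤ m × 9 ≤ n) ⊎ (9 ≤ m × 10 ≤ n)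
split-19 {m} {n} m≤10 n≤10 19≤ with 10 ≤? m
... | yes 10≤m = inj₁ (10≤m , ≤-of-+ m≤10 (subst (19 ≤_) (+-comm m n) 19≤))
... | no  10≰m = inj₂ (≤-of-+ n≤10 19≤ , ≤-of-+ (≤-pred (≰⇒> 10≰m)) (subst (19 ≤_) (+-comm m n) 19≤))

Full×AlmostFull-of-19 : ∀ {D D′} → Unique D → D ⊆ threeSubsets → Unique D′ → D′ ⊆ threeSubsets →
  19 ≤ length D + length D′ → (Full D × AlmostFull D′) ⊎ (AlmostFull D × Full D′)
Full×AlmostFull-of-19 u D⊆ u′ D′⊆ 19≤ =
  Sum.map (λ (10≤ , 9≤) → Full-of-length u D⊆ 10≤ , AlmostFull-of-length u′ D′⊆ 9≤)
          (λ (9≤ , 10≤) → AlmostFull-of-length u D⊆ 9≤ , Full-of-length u′ D′⊆ 10≤)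
          (split-19 (length≤10 u D⊆) (length≤10 u′ D′⊆) 19≤)

Full×AlmostFull-of-T : ∀ A i j i′ j′ → 19 ≤ T A i j + T A i′ j′ →
  (Full (ranges A i j) × AlmostFull (ranges A i′ j′)) ⊎ (AlmostFull (ranges A i j) × Full (ranges A i′ j′))
Full×AlmostFull-of-T A i j i′ j′ =
  Full×AlmostFull-of-19 (ranges-Unique A i j) (ranges⊆threeSubsets {A} {i} {j})
                        (ranges-Unique A i′ j′) (ranges⊆threeSubsets {A} {i′} {j′})

Hits : ∀ {C : Set} → (C → Q5) → (C → Q5) → List (Subset 5) → C → C → Set
Hits p q D c c′ = p c ≢ q c′ × ∁⁅ p c , q c′ ⁆ ∈ D

HitsEither : ∀ {C : Set} → (C → Q5) → (C → Q5) → List (Subset 5) → C → C → Set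
HitsEither p q D c c′ = Hits p q D c c′ ⊎ Hits p q D c′ c

module _ {C : Set} {p q : C → Q5} (p-inj : Injective _≡_ _≡_ p) (q-inj : Injective _≡_ _≡_ q)
         {x y z : C} (x≢y : x ≢ y) (x≢z : x ≢ z) (y≢z : y ≢ z) where

  hits-AlmostFull-Full : ∀ {Dy Dz} → AlmostFull Dy → Full Dz →
    HitsEither p q Dy x y ⊎ HitsEither p q Dz x z
  hits-AlmostFull-Full almost full with p x ≟ q z | p z ≟ q x
  ... | no  px≢qz | _         = inj₂ (inj₁ (px≢qz , full px≢qz))
  ... | yes _     | no  pz≢qx = inj₂ (inj₂ (pz≢qx , full pz≢qx))
  ... | yes px≡qz | yes pz≡qx = inj₁ (Sum.map (px≢qy ,_) (py≢qx ,_) (almost px≢qy py≢qx distinct))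
    where
    px≢qy : p x ≢ q y
    px≢qy px≡qy = y≢z (q-inj (trans (sym px≡qy) px≡qz))
    py≢qx : p y ≢ q x
    py≢qx py≡qx = y≢z (p-inj (trans py≡qx (sym pz≡qx)))
    distinct : ∁⁅ p x , q y ⁆ ≢ ∁⁅ p y , q x ⁆
    distinct eq = [ x≢y ∘ p-inj , x≢z ∘ p-inj ∘ (λ px≡qx → trans px≡qx (sym pz≡qx)) ]′ (∁⁅⁆-≡⇒ eq)

hits : ∀ {C : Set} {p q : C → Q5} → Injective _≡_ _≡_ p → Injective _≡_ _≡_ q →
  ∀ {x y z : C} → x ≢ y → x ≢ z → y ≢ z → ∀ {Dy Dz} →
  (Full Dy × AlmostFull Dz) ⊎ (AlmostFull Dy × Full Dz) →
  HitsEither p q Dy x y ⊎ HitsEither p q Dz x z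
hits p-inj q-inj x≢y x≢z y≢z (inj₁ (full , almost)) =
  Sum.swap (hits-AlmostFull-Full p-inj q-inj x≢z x≢y (y≢z ∘ sym) almost full)
hits p-inj q-inj x≢y x≢z y≢z (inj₂ (almost , full)) =
  hits-AlmostFull-Full p-inj q-inj x≢y x≢z y≢z almost full

-- Completing a transversal of a subarray by two cells of the other layers

module Completion {X : Cube} (latin : IsLayerLatinCube X) {ls : Fin 3 → Q5} (ls-inj : Injective _≡_ _≡_ ls)
                  (O : OtherLayers ls) where

  open OtherLayers O

  private
    A : Cuboid
    A = layersOf X ls

  liftCell : Cell → Point
  liftCell (l , r , c) = ls l , r , c

  Apart-liftCell : ∀ {x y} → B.T (differAll x y) → symbolAt A x ≢ symbolAt A y →
    Apart X (liftCell x) (liftCell y)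
  Apart-liftCell {x} {y} d s≢ = let l≢ , r≢ , c≢ = differAll⁻ {x} {y} d in l≢ ∘ ls-inj , r≢ , c≢ , s≢

  Apart-outside : ∀ {i j w l′ r′ c′} → InSubarray i j w → ls (layerOf w) ≢ l′ → r′ ∈Sᵇ i → c′ ∈Sᵇ j →
    symbolAt A w ≢ X l′ r′ c′ → Apart X (liftCell w) (l′ , r′ , c′)
  Apart-outside {i} {j} (r∉ , c∉) l≢ r′∈ c′∈ s≢ = l≢ , ∉Sᵇ-∈Sᵇ⇒≢ i r∉ r′∈ , ∉Sᵇ-∈Sᵇ⇒≢ j c∉ c′∈ , s≢

  complete : ∀ i j {r₁ r₂ c₁ c₂} → ElemsOf i r₁ r₂ → ElemsOf j c₁ c₂ → X m r₁ c₁ ≢ X n r₂ c₂ →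
    ∁⁅ X m r₁ c₁ , X n r₂ c₂ ⁆ ∈ ranges A i j → HasTransversal X
  complete i j {r₁} {r₂} {c₁} {c₂} (r₁≢r₂ , r₁∈ , r₂∈) (c₁≢c₂ , c₁∈ , c₂∈) s₁≢s₂ V∈
    with ∈ranges⁻ {A} {i} {j} V∈
  ... | (x , y , z) , t∈ , transversal , V≡
    with ∈triples⁻ {i} {j} t∈ | isTransversalᵇ⁻ {A} {x} {y} {z} transversal
  ... | x∈ , y∈ , z∈ | (dxy , dxz , dyz) , sxy , sxz , syz =
    transversal-of-Apart X
      ( (Apart-liftCell dxy sxy ∷ Apart-liftCell dxz sxz ∷ outside x∈ (x∈p∪q⁺ (inj₁ (x∈⁅x⁆ _))))
      ∷ (Apart-liftCell dyz syz ∷ outside y∈ (x∈p∪q⁺ (inj₂ (x∈p∪q⁺ (inj₁ (x∈⁅x⁆ _))))))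
      ∷ outside z∈ (x∈p∪q⁺ (inj₂ (x∈p∪q⁺ (inj₂ (x∈⁅x⁆ _)))))
      ∷ ((m≢n , r₁≢r₂ , c₁≢c₂ , s₁≢s₂) ∷ [])
      ∷ []
      ∷ [])
    where
    outside : ∀ {w} → InSubarray i j w → symbolAt A w ∈ₛ range A (x , y , z) →
      All (Apart X (liftCell w)) ((m , r₁ , c₁) ∷ (n , r₂ , c₂) ∷ [])
    outside {w} w∈ s∈ =
      let s≢₁ , s≢₂ = ∈∁⁅⁆⇒≢ (subst (symbolAt A w ∈ₛ_) (sym V≡) s∈)
      in Apart-outside {i} {j} w∈ (ls≢m (layerOf w)) r₁∈ c₁∈ s≢₁
       ∷ Apart-outside {i} {j} w∈ (ls≢n (layerOf w)) r₂∈ c₂∈ s≢₂ ∷ []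

  complete-rows : ∀ i l {a b c c′} → ElemsOf i a b → ElemsOf l c c′ →
    HitsEither (X m a) (X n b) (ranges A i l) c c′ → HasTransversal X
  complete-rows i l a,b c,c′ (inj₁ (s≢ , V∈)) = complete i l a,b c,c′ s≢ V∈
  complete-rows i l a,b c,c′ (inj₂ (s≢ , V∈)) = complete i l a,b (ElemsOf-swap {l} c,c′) s≢ V∈

  complete-columns : ∀ i l {a b c c′} → ElemsOf i a b → ElemsOf l c c′ →
    HitsEither (λ r → X m r a) (λ r → X n r b) (ranges A l i) c c′ → HasTransversal X
  complete-columns i l a,b c,c′ (inj₁ (s≢ , V∈)) = complete l i c,c′ a,b s≢ V∈
  complete-columns i l a,b c,c′ (inj₂ (s≢ , V∈)) = complete l i (ElemsOf-swap {l} c,c′) a,b s≢ V∈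

  transversal-via-rows : ∀ i j k {a b x y z} → ElemsOf i a b → y ≢ z → ElemsOf j x y → ElemsOf k x z →
    19 ≤ T A i j + T A i k → HasTransversal X
  transversal-via-rows i j k a,b y≢z x,y x,z 19≤ =
    [ complete-rows i j a,b x,y , complete-rows i k a,b x,z ]′
    (hits (proj₁ (latin m) _) (proj₁ (latin n) _) (proj₁ x,y) (proj₁ x,z) y≢z
          (Full×AlmostFull-of-T A i j i k 19≤))

  transversal-via-columns : ∀ i j k {a b x y z} → ElemsOf i a b → y ≢ z → ElemsOf j x y → ElemsOf k x z →
    19 ≤ T A j i + T A k i → HasTransversal X
  transversal-via-columns i j k a,b y≢z x,y x,z 19≤ =
    [ complete-columns i j a,b x,y , complete-columns i k a,b x,z ]′
    (hits (proj₂ (latin m) _) (proj₂ (latin n) _) (proj₁ x,y) (proj₁ x,z) y≢z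
          (Full×AlmostFull-of-T A j i k i 19≤))

corollary5 : (X : Cube) → IsLayerLatinCube X →
    (ls : Fin 3 → Q5) → Injective _≡_ _≡_ ls →
    (i j k : Label) → Adjacent j k →
    (T (layersOf X ls) i j + T (layersOf X ls) i k ≥ 19) ⊎
    (T (layersOf X ls) j i + T (layersOf X ls) k i ≥ 19) →
    HasTransversal X
corollary5 X latin ls ls-inj i j k (j≢k , x , x∈Sj , x∈Sk) =
  let a , b , a,b∈Si = elemsOf i
      y , z , y≢z , x,y∈Sj , x,z∈Sk = adjacent-elemsOf j k x j≢k (∈S⇒∈Sᵇ j x∈Sj) (∈S⇒∈Sᵇ k x∈Sk)
  in [ transversal-via-rows i j k a,b∈Si y≢z x,y∈Sj x,z∈Sk
     , transversal-via-columns i j k a,b∈Si y≢z x,y∈Sj x,z∈Sk ]′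
  where open Completion latin ls-inj (otherLayers ls)
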